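{- Let $\mathbf A\in\mathbf{I}_{2,0}$ and $a,b\in A$ with $0\sqsubseteq a\sqsubseteq b$. Then $b'\sqsubseteq a'$.
   Context: A zroupoid is an algebra $\langle A,\to,0\rangle$ with binary $\to$ and constant $0$; $x':=x\to 0$. An implication zroupoid satisfies (I) $(x\to y)\to z\approx[(z'\to x)\to(y\to z)']'$ and $0''\approx 0$; $\mathbf{I}_{2,0}$ is the variety of implication zroupoids satisfying $x''\approx x$. For $x,y\in A$, $x\sqsubseteq y$ iff $(x\to y')'=x$. -}

module Defs where

open import Level using (Level; suc)
open import Relation.Binary.PropositionalEquality using (_≡_)

record Zroupoid (a : Level) : Set (suc a) where
  infixr 5 _⇒_
  field
    Carrier : Set a
    _⇒_     : Carrier → Carrier → Carrier
    𝟘       : Carrier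

  _′ : Carrier → Carrier
  x ′ = x ⇒ 𝟘

  _⊑_ : Carrier → Carrier → Set a
  x ⊑ y = ((x ⇒ (y ′)) ′) ≡ x

module _ {a : Level} (A : Zroupoid a) where
  open Zroupoid A

  record IsImplicationZroupoid : Set a where
    field
      I-law : ∀ x y z → ((x ⇒ y) ⇒ z) ≡ ((((z ′) ⇒ x) ⇒ ((y ⇒ z) ′)) ′)
      0′′   : ((𝟘 ′) ′) ≡ 𝟘

  record InI₂₀ : Set a where
    field
      isImplicationZroupoid : IsImplicationZroupoid
      involutive            : ∀ x → ((x ′) ′) ≡ x

module Submission where

-- Unfolding ⊑ and using x′′ ≈ x, the goal (b′ → a′′)′ = b′ reduces to the
-- single equation b′ → a = b.  We first derive, from identity (I) and
-- involutivity alone, a few laws valid in every algebra of I₂,₀; the key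
-- ones involve the element 1 := 0′, which is a left unit (1 → x = x):
--   (0 → y) → x = (x → (y → x)′)′             (identity (I) at x := 0)
--   (0 → y) → x = (x → y) → x
--   ((0 → x) → y′)′ = (x → 1) → y.
-- The hypothesis 0 ⊑ a says 0 → a′ = 1; it yields the contraposition law
-- x′ → a′ = a → x and hence a → 1 = 1.  Finally, for any a with a → 1 = 1
-- and a ⊑ b, the two laws above give b′ → a = ((0 → a) → b′)′ = 1 → b = b.

open import Defs
open import Level using (Level)
open import Relation.Binary.PropositionalEquality using (_≡_; sym; cong)
open Relation.Binary.PropositionalEquality.≡-Reasoning

module I₂₀-Properties {ℓ : Level} (A : Zroupoid ℓ) (H : InI₂₀ A) where
  open Zroupoid A
  open InI₂₀ H
  open IsImplicationZroupoid isImplicationZroupoid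

  𝟙 : Carrier
  𝟙 = 𝟘 ′

  neg-shift : ∀ {x y} → x ′ ≡ y → x ≡ y ′
  neg-shift {x} {y} eq = begin
    x       ≡⟨ sym (involutive x) ⟩
    x ′ ′   ≡⟨ cong _′ eq ⟩
    y ′     ∎

  𝟙-unit : ∀ x → 𝟙 ⇒ x ≡ x
  𝟙-unit x = sym (begin
    x                                 ≡⟨ sym (involutive x) ⟩
    (x ⇒ 𝟘) ⇒ 𝟘                       ≡⟨ I-law x 𝟘 𝟘 ⟩
    ((𝟙 ⇒ x) ⇒ ((𝟘 ⇒ 𝟘) ′)) ′         ≡⟨ cong (λ t → ((𝟙 ⇒ x) ⇒ t) ′) 0′′ ⟩
    (𝟙 ⇒ x) ′ ′                       ≡⟨ involutive (𝟙 ⇒ x) ⟩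
    𝟙 ⇒ x                             ∎)

  zero-⇒ : ∀ x y → (𝟘 ⇒ y) ⇒ x ≡ (x ⇒ (y ⇒ x) ′) ′
  zero-⇒ x y = begin
    (𝟘 ⇒ y) ⇒ x                  ≡⟨ I-law 𝟘 y x ⟩
    ((x ′ ′) ⇒ (y ⇒ x) ′) ′      ≡⟨ cong (λ t → (t ⇒ (y ⇒ x) ′) ′) (involutive x) ⟩
    (x ⇒ (y ⇒ x) ′) ′            ∎

  neg-zero-⇒ : ∀ x y → ((𝟘 ⇒ y) ⇒ x) ′ ≡ x ⇒ (y ⇒ x) ′
  neg-zero-⇒ x y = sym (neg-shift (sym (zero-⇒ x y)))

  zero-⇒-𝟙 : 𝟘 ⇒ 𝟙 ≡ 𝟙
  zero-⇒-𝟙 = neg-shift (begin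
    (𝟘 ⇒ 𝟙) ′                 ≡⟨ sym (𝟙-unit ((𝟘 ⇒ 𝟙) ′)) ⟩
    𝟙 ⇒ (𝟘 ⇒ 𝟙) ′             ≡⟨ sym (neg-zero-⇒ 𝟙 𝟘) ⟩
    ((𝟘 ⇒ 𝟘) ⇒ 𝟙) ′           ≡⟨ cong _′ (𝟙-unit 𝟙) ⟩
    𝟘 ′ ′                     ≡⟨ 0′′ ⟩
    𝟘                         ∎)

  ⇒-self-neg : ∀ x → x ⇒ x ′ ≡ x ′
  ⇒-self-neg x = neg-shift (sym (begin
    x                         ≡⟨ sym (𝟙-unit x) ⟩
    𝟙 ⇒ x                     ≡⟨ cong (_⇒ x) (sym zero-⇒-𝟙) ⟩
    (𝟘 ⇒ 𝟙) ⇒ x               ≡⟨ zero-⇒ x 𝟙 ⟩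
    (x ⇒ (𝟙 ⇒ x) ′) ′         ≡⟨ cong (λ t → (x ⇒ t ′) ′) (𝟙-unit x) ⟩
    (x ⇒ x ′) ′               ∎))

  neg-⇒-self : ∀ x → x ′ ⇒ x ≡ x
  neg-⇒-self x = begin
    x ′ ⇒ x                   ≡⟨ cong (x ′ ⇒_) (sym (involutive x)) ⟩
    x ′ ⇒ x ′ ′               ≡⟨ ⇒-self-neg (x ′) ⟩
    x ′ ′                     ≡⟨ involutive x ⟩
    x                         ∎

  zero-⇒-≡-self : ∀ x y → (𝟘 ⇒ y) ⇒ x ≡ (x ⇒ y) ⇒ x
  zero-⇒-≡-self x y = begin
    (𝟘 ⇒ y) ⇒ x                   ≡⟨ zero-⇒ x y ⟩
    (x ⇒ (y ⇒ x) ′) ′             ≡⟨ cong (λ t → (t ⇒ (y ⇒ x) ′) ′) (sym (neg-⇒-self x)) ⟩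
    ((x ′ ⇒ x) ⇒ (y ⇒ x) ′) ′     ≡⟨ sym (I-law x y x) ⟩
    (x ⇒ y) ⇒ x                   ∎

  neg-zero-⇒-neg : ∀ x y → ((𝟘 ⇒ x) ⇒ y ′) ′ ≡ (x ⇒ 𝟙) ⇒ y
  neg-zero-⇒-neg x y = begin
    ((𝟘 ⇒ x) ⇒ y ′) ′                 ≡⟨ cong _′ (zero-⇒-≡-self (y ′) x) ⟩
    ((y ′ ⇒ x) ⇒ y ′) ′               ≡⟨ cong (λ t → ((y ′ ⇒ x) ⇒ t ′) ′) (sym (𝟙-unit y)) ⟩
    ((y ′ ⇒ x) ⇒ (𝟙 ⇒ y) ′) ′         ≡⟨ sym (I-law x 𝟙 y) ⟩
    (x ⇒ 𝟙) ⇒ y                       ∎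

  contraposition : ∀ {a} → 𝟘 ⊑ a → ∀ x → x ′ ⇒ a ′ ≡ a ⇒ x
  contraposition {a} 0⊑a x = begin
    x ′ ⇒ a ′                             ≡⟨ I-law x 𝟘 (a ′) ⟩
    ((a ′ ′ ⇒ x) ⇒ (𝟘 ⇒ a ′) ′) ′         ≡⟨ cong (λ t → ((t ⇒ x) ⇒ (𝟘 ⇒ a ′) ′) ′) (involutive a) ⟩
    ((a ⇒ x) ⇒ (𝟘 ⇒ a ′) ′) ′             ≡⟨ cong (λ t → ((a ⇒ x) ⇒ t) ′) 0⊑a ⟩
    (a ⇒ x) ′ ′                           ≡⟨ involutive (a ⇒ x) ⟩
    a ⇒ x                                 ∎

  ⇒-𝟙 : ∀ {a} → 𝟘 ⊑ a → a ⇒ 𝟙 ≡ 𝟙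
  ⇒-𝟙 {a} 0⊑a = begin
    a ⇒ 𝟙                   ≡⟨ sym (contraposition 0⊑a 𝟙) ⟩
    𝟘 ′ ′ ⇒ a ′             ≡⟨ cong (_⇒ a ′) 0′′ ⟩
    𝟘 ⇒ a ′                 ≡⟨ neg-shift 0⊑a ⟩
    𝟙                       ∎

  neg-⇒-below : ∀ {a b} → a ⇒ 𝟙 ≡ 𝟙 → a ⊑ b → b ′ ⇒ a ≡ b
  neg-⇒-below {a} {b} a⇒𝟙 a⊑b = begin
    b ′ ⇒ a                   ≡⟨ cong (b ′ ⇒_) (sym a⊑b) ⟩
    b ′ ⇒ (a ⇒ b ′) ′         ≡⟨ sym (neg-zero-⇒ (b ′) a) ⟩
    ((𝟘 ⇒ a) ⇒ b ′) ′         ≡⟨ neg-zero-⇒-neg a b ⟩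
    (a ⇒ 𝟙) ⇒ b               ≡⟨ cong (_⇒ b) a⇒𝟙 ⟩
    𝟙 ⇒ b                     ≡⟨ 𝟙-unit b ⟩
    b                         ∎

lemma5p2 : {ℓ : Level} (A : Zroupoid ℓ) → InI₂₀ A →
    (a b : Zroupoid.Carrier A) →
    Zroupoid._⊑_ A (Zroupoid.𝟘 A) a → Zroupoid._⊑_ A a b →
    Zroupoid._⊑_ A (Zroupoid._′ A b) (Zroupoid._′ A a)
lemma5p2 A H a b 0⊑a a⊑b = begin
    (b ′ ⇒ a ′ ′) ′       ≡⟨ cong (λ t → (b ′ ⇒ t) ′) (involutive a) ⟩
    (b ′ ⇒ a) ′           ≡⟨ cong _′ (neg-⇒-below (⇒-𝟙 0⊑a) a⊑b) ⟩
    b ′                   ∎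
  where
    open Zroupoid A
    open InI₂₀ H
    open I₂₀-Properties A H
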